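{- For every pair of positive integers $s,t$ there exists a positive integer $C_{s,t}$ such that for every positive integer $r$, setting $n=C_{s,t}r$, every coloring of the edges of the complete bipartite graph $K_{n,n}$ with $r$ colors contains a monochromatic copy of $K_{s,t}$ or a rainbow copy of $K_{s,t}$.
   Context: An $r$-coloring of a graph assigns to each edge one of $r$ colors. A subgraph is monochromatic if all its edges have the same color, and rainbow if all its edges have pairwise distinct colors. -}

module Defs where

open import Data.Nat using (ℕ)
open import Data.Fin using (Fin)
open import Data.Product using (Σ; _×_; _,_)
open import Data.Sum using (_⊎_)
open import Relation.Binary.PropositionalEquality using (_≡_)
open import Function.Definitions using (Injective)

-- An r-coloring of the edges of K_{n,n}: the edge between left vertex u
-- and right vertex v (both in Fin n) gets color c u v ∈ Fin r.
EdgeColoring : ℕ → ℕ → Set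
EdgeColoring n r = Fin n → Fin n → Fin r

record LeftCopy (n a b : ℕ) : Set where
  field
    left       : Fin a → Fin n
    right      : Fin b → Fin n
    left-inj   : Injective _≡_ _≡_ left
    right-inj  : Injective _≡_ _≡_ right

open LeftCopy public

copyColor : ∀ {n r a b} → EdgeColoring n r → LeftCopy n a b → Fin a → Fin b → Fin r
copyColor c K i j = c (left K i) (right K j)

Monochromatic : ∀ {n r a b} → EdgeColoring n r → LeftCopy n a b → Set
Monochromatic {a = a} {b = b} c K =
  ∀ (i i' : Fin a) (j j' : Fin b) → copyColor c K i j ≡ copyColor c K i' j'

Rainbow : ∀ {n r a b} → EdgeColoring n r → LeftCopy n a b → Set
Rainbow {a = a} {b = b} c K =
  ∀ (i i' : Fin a) (j j' : Fin b) →
    copyColor c K i j ≡ copyColor c K i' j' → (i ≡ i') × (j ≡ j')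

transposeCol : ∀ {n r} → EdgeColoring n r → EdgeColoring n r
transposeCol c u v = c v u

-- c contains a copy of K_{s,t} satisfying P: the s-side lies in either part
-- of K_{n,n} (a copy with s-side in the right part is a copy of the
-- transposed coloring with s-side in the left part).
ContainsCopy : ∀ {n r} (s t : ℕ) → EdgeColoring n r →
               (∀ {a b} → EdgeColoring n r → LeftCopy n a b → Set) → Set
ContainsCopy {n} s t c P =
  Σ (LeftCopy n s t) (λ K → P c K) ⊎ Σ (LeftCopy n s t) (λ K → P (transposeCol c) K)

{-# OPTIONS --safe #-}
-- Call a colour heavy at a vertex if it colours at least n/E of the edges there.  If one side of
-- K_{n,n} has more than r·s(2E)^t heavy (vertex, colour) pairs, some colour a is heavy at more than
-- s(2E)^t vertices of that side.  Choosing t vertices of the other side one at a time, pigeonhole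
-- on the a-neighbourhoods keeps more than s(2E)^(t-j) heavy vertices joined in colour a to all j
-- chosen ones (a heavy vertex still has n/(2E) a-neighbours outside them), and s of the survivors
-- span a monochromatic K_{s,t}.  Otherwise both sides have at most n/4 heavy pairs, and a rainbow
-- K_{s,t} is chosen greedily: first s left vertices without heavy colours, any two of which agree
-- in colour at few light right vertices (by Markov's inequality most vertices qualify), then t
-- right vertices that are light, separate the colours of the chosen left vertices and avoid all
-- colours used so far.  Each constraint excludes at most n/4 vertices, so every step succeeds.
module Submission where

open import Defs
open import Data.Bool using (if_then_else_)
open import Data.Nat using (ℕ; zero; suc; NonZero; nonZero; >-nonZero; >-nonZero⁻¹; _+_; _*_; _∸_; _^_; _≤_; _<_; _≥_; z≤n; s≤s; _≤?_; _<?_)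
open import Data.Nat.Properties
open import Data.Fin using (Fin; zero; suc)
open import Data.Fin.Properties using (all?) renaming (_≟_ to _≟ᶠ_)
open import Data.Vec.Functional using (Vector; []; _∷_)
open import Data.Vec.Functional.Relation.Unary.Any using (Any; any)
import Data.Product as Σ
open import Data.Product using (Σ; Σ-syntax; ∃; _×_; _,_; proj₁; proj₂)
open import Data.Sum using (_⊎_; inj₁; inj₂)
open import Data.Empty using (⊥-elim)
open import Function.Base using (_∘_; id)
open import Function.Definitions using (Injective)
open import Relation.Nullary using (Dec; yes; no; does; ¬_; ¬?; _×-dec_)
open import Relation.Nullary.Decidable using (decidable-stable)
open import Relation.Unary using (Decidable)
open import Relation.Binary.PropositionalEquality
open import Data.Nat.Solver using (module +-*-Solver)
open +-*-Solver
open import Algebra.Properties.CommutativeSemigroup *-commutativeSemigroup using (x∙yz≈y∙xz)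
open import Algebra.Properties.Semiring.Sum +-*-semiring using (sum; sum-cong-≗; ∑-comm; ∑-distrib-+; *-distribˡ-sum; *-distribʳ-sum)

-- Defined through does so that, e.g., 𝟙 (yes p ×-dec q?) and 𝟙 (map′ f g q?) compute to 𝟙 q?.
𝟙 : ∀ {P : Set} → Dec P → ℕ
𝟙 d = if does d then 1 else 0

𝟙≤1 : ∀ {P : Set} (p? : Dec P) → 𝟙 p? ≤ 1
𝟙≤1 (yes _) = ≤-refl
𝟙≤1 (no _)  = z≤n

𝟙-mono : ∀ {P Q : Set} (p? : Dec P) (q? : Dec Q) → (P → Q) → 𝟙 p? ≤ 𝟙 q?
𝟙-mono (yes p) (yes _) _   = ≤-refl
𝟙-mono (yes p) (no ¬q) p⇒q = ⊥-elim (¬q (p⇒q p))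
𝟙-mono (no _)  _       _   = z≤n

𝟙*≤ : ∀ {P : Set} {m k} (p? : Dec P) → (P → m ≤ k) → 𝟙 p? * m ≤ k
𝟙*≤ (yes p) m≤k = ≤-trans (≤-reflexive (+-identityʳ _)) (m≤k p)
𝟙*≤ (no _)  _   = z≤n

𝟙≡1 : ∀ {P : Set} (p? : Dec P) → P → 𝟙 p? ≡ 1
𝟙≡1 (yes _) _ = refl
𝟙≡1 (no ¬p) p = ⊥-elim (¬p p)

𝟙≡0⇒¬ : ∀ {P : Set} (p? : Dec P) → 𝟙 p? ≡ 0 → ¬ P
𝟙≡0⇒¬ (no ¬p) _ = ¬p

0<𝟙⇒ : ∀ {P : Set} (p? : Dec P) → 0 < 𝟙 p? → P
0<𝟙⇒ (yes p) _ = p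

𝟙+𝟙¬≡1 : ∀ {P : Set} (p? : Dec P) → 𝟙 p? + 𝟙 (¬? p?) ≡ 1
𝟙+𝟙¬≡1 (yes _) = refl
𝟙+𝟙¬≡1 (no _)  = refl

count : ∀ {n} {P : Fin n → Set} → Decidable P → ℕ
count P? = sum (λ i → 𝟙 (P? i))

sum-mono-≤ : ∀ {n} {f g : Vector ℕ n} → (∀ i → f i ≤ g i) → sum f ≤ sum g
sum-mono-≤ {zero}  f≤g = z≤n
sum-mono-≤ {suc n} f≤g = +-mono-≤ (f≤g zero) (sum-mono-≤ (f≤g ∘ suc))

sum-const : ∀ n k → sum {n} (λ _ → k) ≡ n * k
sum-const zero    k = refl
sum-const (suc n) k = cong (k +_) (sum-const n k)

sum-ones : ∀ n → sum {n} (λ _ → 1) ≡ n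
sum-ones n = trans (sum-const n 1) (*-identityʳ n)

sum-≤-const : ∀ {n} {f : Vector ℕ n} k → (∀ i → f i ≤ k) → sum f ≤ n * k
sum-≤-const {n} k f≤k = ≤-trans (sum-mono-≤ f≤k) (≤-reflexive (sum-const n k))

≤-sum : ∀ {n} (f : Vector ℕ n) i → f i ≤ sum f
≤-sum f zero    = m≤m+n _ _
≤-sum f (suc i) = ≤-trans (≤-sum (f ∘ suc) i) (m≤n+m _ (f zero))

sum≡0⇒≡0 : ∀ {n} (f : Vector ℕ n) → sum f ≡ 0 → ∀ i → f i ≡ 0
sum≡0⇒≡0 f Σf≡0 i = n≤0⇒n≡0 (subst (f i ≤_) Σf≡0 (≤-sum f i))

pigeonhole : ∀ {n} (f : Vector ℕ n) q → n * q < sum f → ∃ λ i → q < f i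
pigeonhole {suc n} f q n*q<Σf with q <? f zero
... | yes q<f₀ = zero , q<f₀
... | no  q≮f₀ = Σ.map suc id (pigeonhole (f ∘ suc) q
                   (+-cancelˡ-< q _ _ (<-≤-trans n*q<Σf (+-monoˡ-≤ _ (≮⇒≥ q≮f₀)))))

sum<n⇒∃≡0 : ∀ {n} (f : Vector ℕ n) → sum f < n → ∃ λ i → f i ≡ 0
sum<n⇒∃≡0 {suc n} f Σf<n with f zero in f₀≡
... | zero  = zero , f₀≡
... | suc _ = Σ.map suc id (sum<n⇒∃≡0 (f ∘ suc) (≤-trans (s≤s (m≤n+m _ _)) (≤-pred Σf<n)))

0<count⇒∃ : ∀ {n} {P : Fin n → Set} (P? : Decidable P) → 0 < count P? → ∃ P
0<count⇒∃ {n} P? 0<count with pigeonhole (λ i → 𝟙 (P? i)) 0 (subst (_< count P?) (sym (*-zeroʳ n)) 0<count)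
... | i , 0<𝟙 = i , 0<𝟙⇒ (P? i) 0<𝟙

count≡0⇒¬ : ∀ {n} {P : Fin n → Set} (P? : Decidable P) → count P? ≡ 0 → ∀ x → ¬ P x
count≡0⇒¬ P? count≡0 x = 𝟙≡0⇒¬ (P? x) (sum≡0⇒≡0 (λ x → 𝟙 (P? x)) count≡0 x)

count+count∁≡n : ∀ {n} {P : Fin n → Set} (P? : Decidable P) → count P? + count (¬? ∘ P?) ≡ n
count+count∁≡n {n} P? = begin
  count P? + count (¬? ∘ P?)             ≡⟨ ∑-distrib-+ (λ x → 𝟙 (P? x)) (λ x → 𝟙 (¬? (P? x))) ⟨
  sum (λ x → 𝟙 (P? x) + 𝟙 (¬? (P? x)))  ≡⟨ sum-cong-≗ (𝟙+𝟙¬≡1 ∘ P?) ⟩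
  sum {n} (λ _ → 1)                      ≡⟨ sum-ones n ⟩
  n                                      ∎
  where open ≡-Reasoning

count-cong : ∀ {n} {P Q : Fin n → Set} (P? : Decidable P) (Q? : Decidable Q) →
             (∀ {x} → P x → Q x) → (∀ {x} → Q x → P x) → count P? ≡ count Q?
count-cong P? Q? P⇒Q Q⇒P = sum-cong-≗ λ x → ≤-antisym (𝟙-mono (P? x) (Q? x) P⇒Q) (𝟙-mono (Q? x) (P? x) Q⇒P)

count-guarded-≤ : ∀ {n} {P : Set} {Q : Fin n → Set} k m (p? : Dec P) (Q? : Decidable Q) →
                  (P → k * count Q? ≤ m) → k * count (λ x → p? ×-dec Q? x) ≤ m
count-guarded-≤     k m (yes p) Q? bound = bound p
count-guarded-≤ {n} k m (no _)  Q? _     = ≤-trans (≤-reflexive k*0≡0) z≤n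
  where
  k*0≡0 : k * sum {n} (λ _ → 0) ≡ 0
  k*0≡0 = trans (cong (k *_) (trans (sum-const n 0) (*-zeroʳ n))) (*-zeroʳ k)

markov : ∀ {n} (f : Vector ℕ n) k → count (λ i → k ≤? f i) * k ≤ sum f
markov f k = begin
  count (λ i → k ≤? f i) * k        ≡⟨ *-distribʳ-sum k (λ i → 𝟙 (k ≤? f i)) ⟩
  sum (λ i → 𝟙 (k ≤? f i) * k)     ≤⟨ sum-mono-≤ (λ i → 𝟙*≤ (k ≤? f i) id) ⟩
  sum f                             ∎
  where open ≤-Reasoning

*-sum-≤ : ∀ {n} {f : Vector ℕ n} k m → (∀ i → k * f i ≤ m) → k * sum f ≤ n * m
*-sum-≤ {n} {f} k m kf≤m = begin
  k * sum f              ≡⟨ *-distribˡ-sum k f ⟩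
  sum (λ i → k * f i)    ≤⟨ sum-≤-const m kf≤m ⟩
  n * m                  ∎
  where open ≤-Reasoning

_∈_ : ∀ {n j} → Fin n → Vector (Fin n) j → Set
x ∈ g = Any (_≡ x) g

_∉_ : ∀ {n j} → Fin n → Vector (Fin n) j → Set
x ∉ g = ¬ x ∈ g

_∈?_ : ∀ {n j} (x : Fin n) (g : Vector (Fin n) j) → Dec (x ∈ g)
x ∈? g = any (_≟ᶠ x) g

count-≡ : ∀ {n} (y : Fin n) → count (y ≟ᶠ_) ≡ 1
count-≡ {suc n} zero    = cong suc (trans (sum-const n 0) (*-zeroʳ n))
count-≡ {suc n} (suc y) = count-≡ y

count-∈ : ∀ {n j} (g : Vector (Fin n) j) → count (_∈? g) ≤ j
count-∈ {n} {j} g = begin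
  count (_∈? g)                          ≤⟨ sum-mono-≤ 𝟙∈≤ ⟩
  sum (λ x → sum (λ i → 𝟙 (g i ≟ᶠ x)))  ≡⟨ ∑-comm (λ x i → 𝟙 (g i ≟ᶠ x)) ⟩
  sum (λ i → count (g i ≟ᶠ_))            ≡⟨ sum-cong-≗ (count-≡ ∘ g) ⟩
  sum {j} (λ _ → 1)                      ≡⟨ sum-ones j ⟩
  j                                      ∎
  where
  open ≤-Reasoning
  𝟙∈≤ : ∀ x → 𝟙 (x ∈? g) ≤ sum (λ i → 𝟙 (g i ≟ᶠ x))
  𝟙∈≤ x with x ∈? g
  ... | yes (i , gi≡x) = subst (_≤ _) (𝟙≡1 (g i ≟ᶠ x) gi≡x) (≤-sum (λ i → 𝟙 (g i ≟ᶠ x)) i)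
  ... | no _           = z≤n

count≤count∉+ : ∀ {n j} {P : Fin n → Set} (P? : Decidable P) (g : Vector (Fin n) j) →
                count P? ≤ count (λ x → ¬? (x ∈? g) ×-dec P? x) + j
count≤count∉+ {n} {j} P? g = begin
  count P?                                               ≤⟨ sum-mono-≤ split ⟩
  sum (λ x → 𝟙 (¬? (x ∈? g) ×-dec P? x) + 𝟙 (x ∈? g))  ≡⟨ ∑-distrib-+ (λ x → 𝟙 (¬? (x ∈? g) ×-dec P? x)) _ ⟩
  count (λ x → ¬? (x ∈? g) ×-dec P? x) + count (_∈? g)  ≤⟨ +-monoʳ-≤ _ (count-∈ g) ⟩
  count (λ x → ¬? (x ∈? g) ×-dec P? x) + j              ∎
  where
  open ≤-Reasoning
  split : ∀ x → 𝟙 (P? x) ≤ 𝟙 (¬? (x ∈? g) ×-dec P? x) + 𝟙 (x ∈? g)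
  split x with x ∈? g
  ... | yes _ = 𝟙≤1 (P? x)
  ... | no _  = m≤m+n _ 0

avoid : ∀ {n j} (B : Vector ℕ n) (g : Vector (Fin n) j) → sum B + j < n → ∃ λ x → B x ≡ 0 × x ∉ g
avoid {n} {j} B g ΣB+j<n with sum<n⇒∃≡0 (λ x → B x + 𝟙 (x ∈? g)) bound
  where
  open ≤-Reasoning
  bound : sum (λ x → B x + 𝟙 (x ∈? g)) < n
  bound = begin-strict
    sum (λ x → B x + 𝟙 (x ∈? g)) ≡⟨ ∑-distrib-+ B (λ x → 𝟙 (x ∈? g)) ⟩
    sum B + count (_∈? g)         ≤⟨ +-monoʳ-≤ (sum B) (count-∈ g) ⟩
    sum B + j                     <⟨ ΣB+j<n ⟩
    n                             ∎
... | x , Bx+𝟙≡0 = x , m+n≡0⇒m≡0 (B x) Bx+𝟙≡0 , 𝟙≡0⇒¬ (x ∈? g) (m+n≡0⇒n≡0 (B x) Bx+𝟙≡0)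

[]-injective : ∀ {n} → Injective _≡_ _≡_ ([] {A = Fin n})
[]-injective {x = ()}

∷-injective : ∀ {n j} {x : Fin n} {g : Vector (Fin n) j} →
              x ∉ g → Injective _≡_ _≡_ g → Injective _≡_ _≡_ (x ∷ g)
∷-injective x∉g g-inj {zero}  {zero}   _      = refl
∷-injective x∉g g-inj {zero}  {suc i'} x≡gi'  = ⊥-elim (x∉g (i' , sym x≡gi'))
∷-injective x∉g g-inj {suc i} {zero}   gi≡x   = ⊥-elim (x∉g (i , gi≡x))
∷-injective x∉g g-inj {suc i} {suc i'} gi≡gi' = cong suc (g-inj gi≡gi')

module _ {n : ℕ} (Good : ∀ {j} → Vector (Fin n) j → Set) where

  greedy : ∀ k → Good [] →
           (∀ {j} → j < k → (g : Vector (Fin n) j) → Good g → ∃ λ x → x ∉ g × Good (x ∷ g)) →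
           Σ[ g ∈ Vector (Fin n) k ] Injective _≡_ _≡_ g × Good g
  greedy k good[] extend = go k ≤-refl
    where
    go : ∀ j → j ≤ k → Σ[ g ∈ Vector (Fin n) j ] Injective _≡_ _≡_ g × Good g
    go zero    _   = [] , []-injective , good[]
    go (suc j) j<k with go j (<⇒≤ j<k)
    ... | g , g-inj , good with extend j<k g good
    ...   | x , x∉g , good′ = x ∷ g , ∷-injective x∉g g-inj , good′

  greedy-avoiding : ∀ k (Bad : ∀ {j} → Vector (Fin n) j → Vector ℕ n) → Good [] →
                    (∀ {j} → j < k → (g : Vector (Fin n) j) → sum (Bad g) + j < n) →
                    (∀ {j} (g : Vector (Fin n) j) x → Good g → Bad g x ≡ 0 → Good (x ∷ g)) →
                    Σ[ g ∈ Vector (Fin n) k ] Injective _≡_ _≡_ g × Good g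
  greedy-avoiding k Bad good[] few-bad extend = greedy k good[] λ j<k g good →
    let x , bad≡0 , x∉g = avoid (Bad g) g (few-bad j<k g) in x , x∉g , extend g x good bad≡0

choose-distinct : ∀ {n k} {P : Fin n → Set} (P? : Decidable P) → k ≤ count P? →
                  Σ[ h ∈ Vector (Fin n) k ] Injective _≡_ _≡_ h × (∀ i → P (h i))
choose-distinct {n} {k} {P} P? k≤count =
  greedy-avoiding (λ g → ∀ i → P (g i)) k (λ _ x → 𝟙 (¬? (P? x))) (λ ()) few-bad extend
  where
  few-bad : ∀ {j} → j < k → (g : Vector (Fin n) j) → count (¬? ∘ P?) + j < n
  few-bad {j} j<k _ = begin-strict
    count (¬? ∘ P?) + j         <⟨ +-monoʳ-< _ (<-≤-trans j<k k≤count) ⟩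
    count (¬? ∘ P?) + count P?  ≡⟨ +-comm (count (¬? ∘ P?)) (count P?) ⟩
    count P? + count (¬? ∘ P?)  ≡⟨ count+count∁≡n P? ⟩
    n                           ∎
    where open ≤-Reasoning
  extend : ∀ {j} (g : Vector (Fin n) j) x → (∀ i → P (g i)) → 𝟙 (¬? (P? x)) ≡ 0 → ∀ i → P ((x ∷ g) i)
  extend g x _    bad≡0 zero    = decidable-stable (P? x) (𝟙≡0⇒¬ (¬? (P? x)) bad≡0)
  extend g x good _     (suc i) = good i

quarter-bound : ∀ {k m x n} .{{_ : NonZero k}} → k * x ≤ m * n → 4 * m ≤ k → 4 * x ≤ n
quarter-bound {k} {m} {x} {n} kx≤mn 4m≤k = *-cancelˡ-≤ k (begin
  k * (4 * x)    ≡⟨ x∙yz≈y∙xz k 4 x ⟩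
  4 * (k * x)    ≤⟨ *-monoʳ-≤ 4 kx≤mn ⟩
  4 * (m * n)    ≡⟨ *-assoc 4 m n ⟨
  4 * m * n      ≤⟨ *-monoˡ-≤ n 4m≤k ⟩
  k * n          ∎)
  where open ≤-Reasoning

four-quarters : ∀ a b c d {n} → 4 * a ≤ n → 4 * b ≤ n → 4 * c ≤ n → 4 * d < n → a + b + c + d < n
four-quarters a b c d {n} 4a≤n 4b≤n 4c≤n 4d<n = *-cancelˡ-< 4 _ _ (begin-strict
  4 * (a + b + c + d)               ≡⟨ solve 4 (λ a b c d → con 4 :* (a :+ b :+ c :+ d) := con 4 :* a :+ con 4 :* b :+ con 4 :* c :+ con 4 :* d) refl a b c d ⟩
  4 * a + 4 * b + 4 * c + 4 * d     <⟨ +-mono-≤-< (+-mono-≤ (+-mono-≤ 4a≤n 4b≤n) 4c≤n) 4d<n ⟩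
  n + n + n + n                     ≡⟨ solve 1 (λ n → n :+ n :+ n :+ n := con 4 :* n) refl n ⟩
  4 * n                             ∎)
  where open ≤-Reasoning

three-quarters : ∀ a b d {n} → 4 * a ≤ n → 4 * b ≤ n → 4 * d < n → a + b + d < n
three-quarters a b d {n} 4a≤n 4b≤n 4d<n =
  subst (_< n) (cong (_+ d) (+-identityʳ (a + b))) (four-quarters a b 0 d 4a≤n 4b≤n z≤n 4d<n)

module Degrees {n r : ℕ} (E : ℕ) where

  degree : EdgeColoring n r → Fin n → Fin r → ℕ
  degree c u a = count (λ v → c u v ≟ᶠ a)

  Heavy : EdgeColoring n r → Fin n → Fin r → Set
  Heavy c u a = n ≤ E * degree c u a

  heavy? : ∀ c u → Decidable (Heavy c u)
  heavy? c u a = n ≤? E * degree c u a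

  heavyPairs : EdgeColoring n r → ℕ
  heavyPairs c = sum (λ u → count (heavy? c u))

  module MonochromaticCase {{_ : NonZero n}} {s t : ℕ} (c : EdgeColoring n r) (a : Fin r)
                           (2Et≤n : 2 * E * t ≤ n) where

    Common : ∀ {j} → Vector (Fin n) j → Fin n → Set
    Common g u = Heavy c u a × (∀ i → c u (g i) ≡ a)

    common? : ∀ {j} (g : Vector (Fin n) j) → Decidable (Common g)
    common? g u = heavy? c u a ×-dec all? (λ i → c u (g i) ≟ᶠ a)

    target : ℕ → ℕ
    target j = s * (2 * E) ^ (t ∸ j)

    target-suc : ∀ {j} → j < t → 2 * E * target (suc j) ≡ target j
    target-suc {j} j<t = begin
      2 * E * (s * (2 * E) ^ (t ∸ suc j))  ≡⟨ x∙yz≈y∙xz (2 * E) s _ ⟩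
      s * (2 * E) ^ suc (t ∸ suc j)        ≡⟨ cong (λ k → s * (2 * E) ^ k) (+-∸-assoc 1 j<t) ⟨
      s * (2 * E) ^ (t ∸ j)                ∎
      where open ≡-Reasoning

    Large : ∀ {j} → Vector (Fin n) j → Set
    Large {j} g = target j < count (common? g)

    module _ {j : ℕ} (j<t : j < t) (g : Vector (Fin n) j) where

      freshEdge? : ∀ u v → Dec (v ∉ g × c u v ≡ a)
      freshEdge? u v = ¬? (v ∈? g) ×-dec c u v ≟ᶠ a

      freshDegree : Fin n → ℕ
      freshDegree u = count (freshEdge? u)

      neighbours : Fin n → ℕ
      neighbours v = count (λ u → common? g u ×-dec freshEdge? u v)

      heavy⇒freshDegree : ∀ u → Heavy c u a → n ≤ 2 * E * freshDegree u
      heavy⇒freshDegree u heavy = +-cancelʳ-≤ n n _ (begin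
        n + n                                      ≤⟨ +-mono-≤ n≤E[D+j] n≤E[D+j] ⟩
        E * (freshDegree u + j) + E * (freshDegree u + j)
          ≡⟨ solve 3 (λ e d k → e :* (d :+ k) :+ e :* (d :+ k) := con 2 :* e :* d :+ con 2 :* e :* k) refl E (freshDegree u) j ⟩
        2 * E * freshDegree u + 2 * E * j          ≤⟨ +-monoʳ-≤ _ (≤-trans (*-monoʳ-≤ (2 * E) (<⇒≤ j<t)) 2Et≤n) ⟩
        2 * E * freshDegree u + n                  ∎)
        where
        open ≤-Reasoning
        n≤E[D+j] : n ≤ E * (freshDegree u + j)
        n≤E[D+j] = ≤-trans heavy (*-monoʳ-≤ E (count≤count∉+ (λ v → c u v ≟ᶠ a) g))

      many-neighbours : Large g → n * target (suc j) < sum neighbours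
      many-neighbours large = *-cancelˡ-< (2 * E) _ _ (begin-strict
        2 * E * (n * target (suc j))          ≡⟨ x∙yz≈y∙xz (2 * E) n _ ⟩
        n * (2 * E * target (suc j))          ≡⟨ cong (n *_) (target-suc j<t) ⟩
        n * target j                          <⟨ *-monoʳ-< n large ⟩
        n * count (common? g)                 ≡⟨ *-comm n _ ⟩
        count (common? g) * n                 ≡⟨ *-distribʳ-sum n (λ u → 𝟙 (common? g u)) ⟩
        sum (λ u → 𝟙 (common? g u) * n)      ≤⟨ sum-mono-≤ pointwise ⟩
        sum (λ u → 2 * E * sum (w u))         ≡⟨ *-distribˡ-sum (2 * E) (λ u → sum (w u)) ⟨
        2 * E * sum (λ u → sum (w u))         ≡⟨ cong (2 * E *_) (∑-comm w) ⟩
        2 * E * sum neighbours                ∎)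
        where
        open ≤-Reasoning
        w : Fin n → Fin n → ℕ
        w u v = 𝟙 (common? g u ×-dec freshEdge? u v)
        pointwise : ∀ u → 𝟙 (common? g u) * n ≤ 2 * E * sum (w u)
        pointwise u = 𝟙*≤ (common? g u) λ common →
          ≤-trans (heavy⇒freshDegree u (proj₁ common))
                  (*-monoʳ-≤ (2 * E) (sum-mono-≤ λ v → 𝟙-mono (freshEdge? u v) (common? g u ×-dec freshEdge? u v) (common ,_)))

      extend : Large g → ∃ λ v → v ∉ g × Large (v ∷ g)
      extend large with pigeonhole neighbours (target (suc j)) (many-neighbours large)
      ... | v , many = v , v∉g , <-≤-trans many (sum-mono-≤ λ u → 𝟙-mono (common? g u ×-dec freshEdge? u v) (common? (v ∷ g) u) widen)
        where
        v∉g : v ∉ g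
        v∉g = proj₁ (proj₂ (proj₂ (0<count⇒∃ (λ u → common? g u ×-dec freshEdge? u v) (≤-<-trans z≤n many))))
        widen : ∀ {u} → Common g u × (v ∉ g × c u v ≡ a) → Common (v ∷ g) u
        widen ((heavy , all) , _ , cuv≡a) = heavy , λ { zero → cuv≡a ; (suc i) → all i }

    large[] : s * (2 * E) ^ t < count (λ u → heavy? c u a) → Large []
    large[] many-heavy = <-≤-trans many-heavy (sum-mono-≤ λ u → 𝟙-mono (heavy? c u a) (common? [] u) (_, λ ()))

    large⇒s≤common : (g : Vector (Fin n) t) → Large g → s ≤ count (common? g)
    large⇒s≤common g large = ≤-trans (≤-reflexive s≡target) (<⇒≤ large)
      where
      s≡target : s ≡ target t
      s≡target = trans (sym (*-identityʳ s)) (cong (λ k → s * (2 * E) ^ k) (sym (n∸n≡0 t)))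

    monochromatic-copy : s * (2 * E) ^ t < count (λ u → heavy? c u a) → Σ (LeftCopy n s t) (Monochromatic c)
    monochromatic-copy many-heavy =
      let g , g-inj , large    = greedy Large t (large[] many-heavy) extend
          h , h-inj , h-common = choose-distinct (common? g) (large⇒s≤common g large)
      in record { left = h ; right = g ; left-inj = h-inj ; right-inj = g-inj } ,
         λ i i' k k' → trans (proj₂ (h-common i) k) (sym (proj₂ (h-common i') k'))

  heavy-colour : ∀ c M → r * M < heavyPairs c → ∃ λ a → M < count (λ u → heavy? c u a)
  heavy-colour c M many = pigeonhole (λ a → count (λ u → heavy? c u a)) M
                            (subst (r * M <_) (∑-comm (λ u a → 𝟙 (heavy? c u a))) many)

  no-heavy⇒degree< : ∀ c u → count (heavy? c u) ≡ 0 → ∀ b → E * degree c u b < n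
  no-heavy⇒degree< c u no-heavy b = ≰⇒> (count≡0⇒¬ (heavy? c u) no-heavy b)

  module RainbowCase {{_ : NonZero n}} {{_ : NonZero E}} (c : EdgeColoring n r) (A : ℕ) {{_ : NonZero A}} where

    lightʳ? : ∀ v → Dec (count (heavy? (transposeCol c) v) ≡ 0)
    lightʳ? v = count (heavy? (transposeCol c) v) ≟ 0

    -- Only light right vertices count: each has fewer than n/E neighbours x in any colour,
    -- which bounds the sum of conflicts x y over x by n²/E.
    conflicts : Fin n → Fin n → ℕ
    conflicts x y = count (λ v → lightʳ? v ×-dec c x v ≟ᶠ c y v)

    conflicts-sym : ∀ x y → conflicts x y ≡ conflicts y x
    conflicts-sym x y = count-cong (λ v → lightʳ? v ×-dec c x v ≟ᶠ c y v) (λ v → lightʳ? v ×-dec c y v ≟ᶠ c x v)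
                                   (Σ.map id sym) (Σ.map id sym)

    sum-conflicts : ∀ y → E * sum (λ x → conflicts x y) ≤ n * n
    sum-conflicts y = begin
      E * sum (λ x → conflicts x y)                                  ≡⟨ cong (E *_) (∑-comm (λ x v → 𝟙 (lightʳ? v ×-dec c x v ≟ᶠ c y v))) ⟩
      E * sum (λ v → count (λ x → lightʳ? v ×-dec c x v ≟ᶠ c y v))  ≤⟨ *-sum-≤ E n light-column ⟩
      n * n                                                          ∎
      where
      open ≤-Reasoning
      light-column : ∀ v → E * count (λ x → lightʳ? v ×-dec c x v ≟ᶠ c y v) ≤ n
      light-column v = count-guarded-≤ E n (lightʳ? v) (λ x → c x v ≟ᶠ c y v)
                         λ v-light → <⇒≤ (no-heavy⇒degree< (transposeCol c) v v-light (c y v))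

    clash? : ∀ x y → Dec (n * A ≤ E * conflicts x y)
    clash? x y = n * A ≤? E * conflicts x y

    few-clashes : ∀ y → A * count (λ x → clash? x y) ≤ n
    few-clashes y = *-cancelˡ-≤ n (begin
      n * (A * count (λ x → clash? x y))  ≡⟨ solve 3 (λ n a k → n :* (a :* k) := k :* (n :* a)) refl n A _ ⟩
      count (λ x → clash? x y) * (n * A)  ≤⟨ markov (λ x → E * conflicts x y) (n * A) ⟩
      sum (λ x → E * conflicts x y)       ≡⟨ *-distribˡ-sum E (λ x → conflicts x y) ⟨
      E * sum (λ x → conflicts x y)       ≤⟨ sum-conflicts y ⟩
      n * n                               ∎)
      where open ≤-Reasoning

    Admissible : ∀ {j} → Vector (Fin n) j → Set
    Admissible g = (∀ i b → E * degree c (g i) b < n) ×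
                   (∀ i i' → i ≢ i' → E * conflicts (g i) (g i') < n * A)

    admissible-left : ∀ s → 4 * heavyPairs c ≤ n → 4 * s ≤ n → 4 * s ≤ A →
                      Σ[ u ∈ Vector (Fin n) s ] Injective _≡_ _≡_ u × Admissible u
    admissible-left s 4H≤n 4s≤n 4s≤A = greedy-avoiding Admissible s bad ((λ ()) , (λ ())) few-bad extend
      where
      bad : ∀ {j} → Vector (Fin n) j → Vector ℕ n
      bad g x = count (heavy? c x) + sum (λ i → 𝟙 (clash? x (g i)))

      few-bad : ∀ {j} → j < s → (g : Vector (Fin n) j) → sum (bad g) + j < n
      few-bad {j} j<s g = begin-strict
        sum (bad g) + j
          ≡⟨ cong (_+ j) (∑-distrib-+ (λ x → count (heavy? c x)) (λ x → sum (λ i → 𝟙 (clash? x (g i))))) ⟩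
        heavyPairs c + sum (λ x → sum (λ i → 𝟙 (clash? x (g i)))) + j
          ≡⟨ cong (λ k → heavyPairs c + k + j) (∑-comm (λ x i → 𝟙 (clash? x (g i)))) ⟩
        heavyPairs c + clashes + j
          <⟨ three-quarters (heavyPairs c) clashes j 4H≤n 4clashes≤n (<-≤-trans (*-monoʳ-< 4 j<s) 4s≤n) ⟩
        n ∎
        where
        open ≤-Reasoning
        clashes : ℕ
        clashes = sum (λ i → count (λ x → clash? x (g i)))
        4clashes≤n : 4 * clashes ≤ n
        4clashes≤n = quarter-bound {m = s} (≤-trans (*-sum-≤ A n (few-clashes ∘ g)) (*-monoˡ-≤ n (<⇒≤ j<s))) 4s≤A

      extend : ∀ {j} (g : Vector (Fin n) j) x → Admissible g → bad g x ≡ 0 → Admissible (x ∷ g)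
      extend g x (light-g , sparse-g) bad≡0 = light-xg , sparse-xg
        where
        no-clash : ∀ i → E * conflicts x (g i) < n * A
        no-clash i = ≰⇒> (𝟙≡0⇒¬ (clash? x (g i)) (sum≡0⇒≡0 _ (m+n≡0⇒n≡0 _ bad≡0) i))
        light-xg : ∀ i b → E * degree c ((x ∷ g) i) b < n
        light-xg zero    = no-heavy⇒degree< c x (m+n≡0⇒m≡0 _ bad≡0)
        light-xg (suc i) = light-g i
        sparse-xg : ∀ i i' → i ≢ i' → E * conflicts ((x ∷ g) i) ((x ∷ g) i') < n * A
        sparse-xg zero    zero     i≢i' = ⊥-elim (i≢i' refl)
        sparse-xg zero    (suc i') _    = no-clash i'
        sparse-xg (suc i) zero     _    = subst (λ k → E * k < n * A) (conflicts-sym x (g i)) (no-clash i)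
        sparse-xg (suc i) (suc i') i≢i' = sparse-g i i' (i≢i' ∘ cong suc)

    module _ {s : ℕ} (u : Vector (Fin n) s)
             (light-u : ∀ i b → E * degree c (u i) b < n)
             (sparse-u : ∀ i i' → i ≢ i' → E * conflicts (u i) (u i') < n * A) where

      RainbowWith : ∀ {j} → Vector (Fin n) j → Set
      RainbowWith g = ∀ i i' k k' → c (u i) (g k) ≡ c (u i') (g k') → i ≡ i' × k ≡ k'

      repeat? : ∀ v i i' → Dec (i ≢ i' × (count (heavy? (transposeCol c) v) ≡ 0 × c (u i) v ≡ c (u i') v))
      repeat? v i i' = ¬? (i ≟ᶠ i') ×-dec (lightʳ? v ×-dec c (u i) v ≟ᶠ c (u i') v)

      repeats : Fin n → ℕ
      repeats v = sum (λ i → count (repeat? v i))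

      reused : ∀ {j} → Vector (Fin n) j → Fin n → ℕ
      reused g v = sum (λ i → sum (λ i' → count (λ k → c (u i) v ≟ᶠ c (u i') (g k))))

      few-repeats : 4 * (s * (s * A)) ≤ E → 4 * sum repeats ≤ n
      few-repeats 4s²A≤E = quarter-bound {m = s * (s * A)} (begin
        E * sum repeats                                               ≡⟨ cong (E *_) by-pairs ⟩
        E * sum (λ i → sum (λ i' → count (λ v → repeat? v i i')))    ≤⟨ *-sum-≤ E _ (λ i → *-sum-≤ E _ (pair-bound i)) ⟩
        s * (s * (n * A))                                             ≡⟨ solve 3 (λ s n a → s :* (s :* (n :* a)) := s :* (s :* a) :* n) refl s n A ⟩
        s * (s * A) * n                                               ∎) 4s²A≤E
        where
        open ≤-Reasoning
        by-pairs : sum repeats ≡ sum (λ i → sum (λ i' → count (λ v → repeat? v i i')))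
        by-pairs = trans (∑-comm (λ v i → count (repeat? v i)))
                         (sum-cong-≗ λ i → ∑-comm (λ v i' → 𝟙 (repeat? v i i')))
        pair-bound : ∀ i i' → E * count (λ v → repeat? v i i') ≤ n * A
        pair-bound i i' = count-guarded-≤ E (n * A) (¬? (i ≟ᶠ i')) (λ v → lightʳ? v ×-dec c (u i) v ≟ᶠ c (u i') v)
                            λ i≢i' → <⇒≤ (sparse-u i i' i≢i')

      few-reused : ∀ {j t} → j ≤ t → 4 * (s * (s * t)) ≤ E → (g : Vector (Fin n) j) → 4 * sum (reused g) ≤ n
      few-reused {j} {t} j≤t 4s²t≤E g = quarter-bound {m = s * (s * t)} (begin
        E * sum (reused g)                   ≡⟨ cong (E *_) by-triples ⟩
        E * sum (λ i → sum (λ i' → sum (λ k → degree c (u i) (c (u i') (g k)))))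
          ≤⟨ *-sum-≤ E _ (λ i → *-sum-≤ E _ (λ i' → *-sum-≤ E n (λ k → <⇒≤ (light-u i (c (u i') (g k)))))) ⟩
        s * (s * (j * n))                    ≤⟨ *-monoʳ-≤ s (*-monoʳ-≤ s (*-monoˡ-≤ n j≤t)) ⟩
        s * (s * (t * n))                    ≡⟨ solve 3 (λ s t n → s :* (s :* (t :* n)) := s :* (s :* t) :* n) refl s t n ⟩
        s * (s * t) * n                      ∎) 4s²t≤E
        where
        open ≤-Reasoning
        by-triples : sum (reused g) ≡ sum (λ i → sum (λ i' → sum (λ k → degree c (u i) (c (u i') (g k)))))
        by-triples = trans (∑-comm (λ v i → sum (λ i' → count (λ k → c (u i) v ≟ᶠ c (u i') (g k)))))
                    (sum-cong-≗ λ i → trans (∑-comm (λ v i' → count (λ k → c (u i) v ≟ᶠ c (u i') (g k))))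
                    (sum-cong-≗ λ i' → ∑-comm (λ v k → 𝟙 (c (u i) v ≟ᶠ c (u i') (g k)))))

      obstacles : ∀ {j} → Vector (Fin n) j → Vector ℕ n
      obstacles g v = count (heavy? (transposeCol c) v) + repeats v + reused g v

      extend-rainbow : ∀ {j} (g : Vector (Fin n) j) v → RainbowWith g → obstacles g v ≡ 0 → RainbowWith (v ∷ g)
      extend-rainbow g v rainbow-g unobstructed = rainbow-vg
        where
        heavyᵀ : ℕ
        heavyᵀ = count (heavy? (transposeCol c) v)
        heavyᵀ+repeats≡0 : heavyᵀ + repeats v ≡ 0
        heavyᵀ+repeats≡0 = m+n≡0⇒m≡0 (heavyᵀ + repeats v) unobstructed
        v-light : heavyᵀ ≡ 0
        v-light = m+n≡0⇒m≡0 heavyᵀ heavyᵀ+repeats≡0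
        distinct : ∀ i i' → i ≢ i' → c (u i) v ≢ c (u i') v
        distinct i i' i≢i' same =
          count≡0⇒¬ (repeat? v i) (sum≡0⇒≡0 (λ i → count (repeat? v i)) (m+n≡0⇒n≡0 heavyᵀ heavyᵀ+repeats≡0) i) i'
            (i≢i' , v-light , same)
        unused : ∀ i i' k → c (u i) v ≢ c (u i') (g k)
        unused i i' k = count≡0⇒¬ (λ k → c (u i) v ≟ᶠ c (u i') (g k))
          (sum≡0⇒≡0 _ (sum≡0⇒≡0 _ (m+n≡0⇒n≡0 (heavyᵀ + repeats v) unobstructed) i) i') k
        rainbow-vg : RainbowWith (v ∷ g)
        rainbow-vg i i' zero zero same with i ≟ᶠ i'
        ... | yes i≡i' = i≡i' , refl
        ... | no  i≢i' = ⊥-elim (distinct i i' i≢i' same)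
        rainbow-vg i i' zero    (suc k') same = ⊥-elim (unused i i' k' same)
        rainbow-vg i i' (suc k) zero     same = ⊥-elim (unused i' i k (sym same))
        rainbow-vg i i' (suc k) (suc k') same = Σ.map id (cong suc) (rainbow-g i i' k k' same)

      rainbow-right : ∀ t → 4 * heavyPairs (transposeCol c) ≤ n → 4 * t ≤ n →
                      4 * (s * (s * A)) ≤ E → 4 * (s * (s * t)) ≤ E →
                      Σ[ g ∈ Vector (Fin n) t ] Injective _≡_ _≡_ g × RainbowWith g
      rainbow-right t 4Hᵀ≤n 4t≤n 4s²A≤E 4s²t≤E = greedy-avoiding RainbowWith t obstacles (λ _ _ ()) few-obstacles extend-rainbow
        where
        few-obstacles : ∀ {j} → j < t → (g : Vector (Fin n) j) → sum (obstacles g) + j < n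
        few-obstacles {j} j<t g = begin-strict
          sum (obstacles g) + j
            ≡⟨ cong (_+ j) (∑-distrib-+ (λ v → count (heavy? (transposeCol c) v) + repeats v) (reused g)) ⟩
          sum (λ v → count (heavy? (transposeCol c) v) + repeats v) + sum (reused g) + j
            ≡⟨ cong (λ k → k + sum (reused g) + j) (∑-distrib-+ (λ v → count (heavy? (transposeCol c) v)) repeats) ⟩
          heavyPairs (transposeCol c) + sum repeats + sum (reused g) + j
            <⟨ four-quarters (heavyPairs (transposeCol c)) (sum repeats) (sum (reused g)) j
                 4Hᵀ≤n (few-repeats 4s²A≤E) (few-reused (<⇒≤ j<t) 4s²t≤E g) (<-≤-trans (*-monoʳ-< 4 j<t) 4t≤n) ⟩
          n ∎
          where open ≤-Reasoning

    rainbow-copy : ∀ s t → 4 * heavyPairs c ≤ n → 4 * heavyPairs (transposeCol c) ≤ n →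
                   4 * s ≤ n → 4 * t ≤ n → 4 * s ≤ A → 4 * (s * (s * A)) ≤ E → 4 * (s * (s * t)) ≤ E →
                   Σ (LeftCopy n s t) (Rainbow c)
    rainbow-copy s t 4H≤n 4Hᵀ≤n 4s≤n 4t≤n 4s≤A 4s²A≤E 4s²t≤E =
      let u , u-inj , light-u , sparse-u = admissible-left s 4H≤n 4s≤n 4s≤A
          g , g-inj , rainbow            = rainbow-right u light-u sparse-u t 4Hᵀ≤n 4t≤n 4s²A≤E 4s²t≤E
      in record { left = u ; right = g ; left-inj = u-inj ; right-inj = g-inj } , rainbow

module Constants (s t : ℕ) {{s≢0 : NonZero s}} {{t≢0 : NonZero t}} where

  -- A keeps the clashes of a left vertex below n/(4s), E keeps repeated and reused colours below
  -- n/4 right vertices each, and C makes n = C r large enough for 2Et ≤ n, 4rM ≤ n and the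
  -- remaining quarter bounds.
  A : ℕ
  A = 4 * s

  E : ℕ
  E = 4 * (s * (s * (A * t)))

  M : ℕ
  M = s * (2 * E) ^ t

  instance
    A-nonZero : NonZero A
    A-nonZero = m*n≢0 4 s
    E-nonZero : NonZero E
    E-nonZero = m*n≢0 4 (s * (s * (A * t))) {{nonZero}}
                  {{m*n≢0 s (s * (A * t)) {{s≢0}} {{m*n≢0 s (A * t) {{s≢0}} {{m*n≢0 A t {{A-nonZero}} {{t≢0}}}}}}}}

  C : ℕ
  C = 4 * s + 4 * t + 2 * E * t + 4 * M

  4s²A≤E : 4 * (s * (s * A)) ≤ E
  4s²A≤E = *-monoʳ-≤ 4 (*-monoʳ-≤ s (*-monoʳ-≤ s (m≤m*n A t)))

  4s²t≤E : 4 * (s * (s * t)) ≤ E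
  4s²t≤E = *-monoʳ-≤ 4 (*-monoʳ-≤ s (*-monoʳ-≤ s (m≤n*m t A)))

  4s≤C : 4 * s ≤ C
  4s≤C = ≤-trans (m≤m+n _ _) (≤-trans (m≤m+n _ _) (m≤m+n _ _))

  4t≤C : 4 * t ≤ C
  4t≤C = ≤-trans (m≤n+m _ (4 * s)) (≤-trans (m≤m+n _ _) (m≤m+n _ _))

  2Et≤C : 2 * E * t ≤ C
  2Et≤C = ≤-trans (m≤n+m _ (4 * s + 4 * t)) (m≤m+n _ _)

  4M≤C : 4 * M ≤ C
  4M≤C = m≤n+m _ (4 * s + 4 * t + 2 * E * t)

  0<C : 0 < C
  0<C = <-≤-trans (>-nonZero⁻¹ A) 4s≤C

module Dichotomy (s t r : ℕ) {{_ : NonZero s}} {{_ : NonZero t}} {{_ : NonZero r}} where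
  open Constants s t

  n : ℕ
  n = C * r

  C≤n : C ≤ n
  C≤n = m≤m*n C r

  4rM≤n : 4 * (r * M) ≤ n
  4rM≤n = ≤-trans (≤-reflexive (x∙yz≈y∙xz 4 r M)) (≤-trans (*-monoʳ-≤ r 4M≤C) (≤-reflexive (*-comm r C)))

  instance
    n-nonZero : NonZero n
    n-nonZero = >-nonZero (<-≤-trans 0<C C≤n)

  open Degrees {n} {r} E

  monochromatic : ∀ c → r * M < heavyPairs c → Σ (LeftCopy n s t) (Monochromatic c)
  monochromatic c many = let a , many-a = heavy-colour c M many in
    MonochromaticCase.monochromatic-copy c a (≤-trans 2Et≤C C≤n) many-a

  rainbow : ∀ c → heavyPairs c ≤ r * M → heavyPairs (transposeCol c) ≤ r * M → Σ (LeftCopy n s t) (Rainbow c)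
  rainbow c few fewᵀ = RainbowCase.rainbow-copy c A s t (≤-trans (*-monoʳ-≤ 4 few) 4rM≤n)
    (≤-trans (*-monoʳ-≤ 4 fewᵀ) 4rM≤n) (≤-trans 4s≤C C≤n) (≤-trans 4t≤C C≤n) ≤-refl 4s²A≤E 4s²t≤E

  monochromatic-or-rainbow : ∀ c → ContainsCopy s t c Monochromatic ⊎ ContainsCopy s t c Rainbow
  monochromatic-or-rainbow c with heavyPairs c ≤? r * M | heavyPairs (transposeCol c) ≤? r * M
  ... | no  many | _         = inj₁ (inj₁ (monochromatic c (≰⇒> many)))
  ... | yes _    | no  manyᵀ = inj₁ (inj₂ (monochromatic (transposeCol c) (≰⇒> manyᵀ)))
  ... | yes few  | yes fewᵀ  = inj₂ (inj₁ (rainbow c few fewᵀ))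

theorem1 : (s t : ℕ) → s ≥ 1 → t ≥ 1 →
    Σ ℕ (λ C → C ≥ 1 ×
      ((r : ℕ) → r ≥ 1 → (c : EdgeColoring (C * r) r) →
        ContainsCopy s t c Monochromatic ⊎ ContainsCopy s t c Rainbow))
theorem1 s t s≥1 t≥1 = C , 0<C , λ r r≥1 → Dichotomy.monochromatic-or-rainbow s t r {{s-nonZero}} {{t-nonZero}} {{>-nonZero r≥1}}
  where
  instance
    s-nonZero : NonZero s
    s-nonZero = >-nonZero s≥1
    t-nonZero : NonZero t
    t-nonZero = >-nonZero t≥1
  open Constants s t
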